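{- Let $m\ge 4$ with $m\ne 6$. Let $G_{10}$ be the voltage graph over $\mathbb{Z}_m$ defined as follows. Take the tree with vertices $x^{*},x,x_0,x_1,x_{01},x_{10},x_{11},x_{010},x_{011},x_{100},x_{101},x_{110},x_{111}$ and edges $x^{*}x$, $xx_0$, $xx_1$, $x_0x_{01}$, $x_1x_{10}$, $x_1x_{11}$, $x_{01}x_{010}$, $x_{01}x_{011}$, $x_{10}x_{100}$, $x_{10}x_{101}$, $x_{11}x_{110}$, $x_{11}x_{111}$, an identical copy of it with every $x$ replaced by $y$, and the edge $x_0y_0$; all these edges have voltage $0$, and $x^{*},y^{*}$ are pinned. Add the following labelled arcs: $x_{010}\to y_{010}$ (1), $x_{010}\to y_{111}$ (2), $x_{011}\to y_{011}$ (2), $x_{011}\to y_{110}$ (1), $x_{100}\to y_{010}$ (2), $x_{100}\to y_{101}$ (1), $x_{101}\to y_{011}$ (1), $x_{101}\to y_{100}$ (2), $x_{110}\to y_{110}$ (2), $x_{110}\to y_{111}$ (1), $x_{111}\to y_{100}$ (3), $x_{111}\to y_{101}$ (0). Then the derived graph $(G_{10},m)$ has girth $10$; it is a $(3,m;10)$-graph with $2$ vertices of degree $m$ (namely $x^{*},y^{*}$) and $24m$ vertices of degree $3$.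
   Context: A voltage graph over $\mathbb{Z}_m$ is a finite directed multigraph with arc labels in $\mathbb{Z}_m$; some degree-$1$ vertices are pinned. Derived graph $(G,m)$: each non-pinned vertex $v$ gives $m$ vertices $v^0,\dots,v^{m-1}$; each pinned vertex $v^{*}$ gives a single vertex; an arc $v\to w$ labelled $a$ between non-pinned vertices gives edges $v^iw^{i+a}$ for all $i$ (indices mod $m$); an edge $v^{*}w$ with $v^{*}$ pinned gives edges $v^{*}w^i$ for all $i$. A $(3,m;g)$-graph is a graph of girth $g$ all of whose vertices have degree $3$ or $m$. -}

module Defs where

open import Data.Nat using (ℕ; zero; suc; _+_; _*_; _<_; NonZero; _≟_)
open import Data.Nat.DivMod using (_mod_)
open import Data.Bool using (Bool; true; false; if_then_else_; not; _∨_)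
open import Data.Fin using (Fin; toℕ; #_)
open import Data.Fin.Properties using () renaming (_≟_ to _≟ᶠ_)
open import Data.List using (List; []; _∷_; _++_; map; concatMap; filterᵇ; allFin; length)
open import Data.Nat.ListAction using (sum)
open import Data.Product using (_×_; _,_; proj₁; proj₂; Σ)
open import Data.Sum using (_⊎_; inj₁; inj₂)
import Data.Sum.Properties as SumP
import Data.Product.Properties as ProdP
open import Relation.Binary.PropositionalEquality using (_≡_)
open import Relation.Binary.Definitions using (DecidableEquality)
open import Relation.Nullary using (does)
open import Function.Definitions using (Injective)

record Multigraph : Set₁ where
  field
    V        : Set
    _≟V_     : DecidableEquality V
    vertices : List V
    edges    : List (V × V)        -- the edge multiset; each entry is an (undirected) edge

open Multigraph public

EdgeIx : Multigraph → Set
EdgeIx G = Fin (length (edges G))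

edgeAt : (G : Multigraph) → EdgeIx G → V G × V G
edgeAt G e = Data.List.lookup (edges G) e

Joins : (G : Multigraph) → EdgeIx G → V G → V G → Set
Joins G e u w = (proj₁ (edgeAt G e) ≡ u × proj₂ (edgeAt G e) ≡ w)
              ⊎ (proj₁ (edgeAt G e) ≡ w × proj₂ (edgeAt G e) ≡ u)

csuc : ∀ {k} → Fin k → Fin k
csuc {suc k} i = (suc (toℕ i)) mod (suc k)

record Cycle (G : Multigraph) (k : ℕ) : Set where
  field
    nonempty : 0 < k
    vert     : Fin k → V G
    edge     : Fin k → EdgeIx G
    vert-inj : Injective _≡_ _≡_ vert
    edge-inj : Injective _≡_ _≡_ edge
    joins    : ∀ i → Joins G (edge i) (vert i) (vert (csuc i))

HasGirth : Multigraph → ℕ → Set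
HasGirth G g = Cycle G g × (∀ k → k < g → Cycle G k → Data.Empty.⊥)
  where import Data.Empty

-- degree (a loop counts twice)
degree : (G : Multigraph) → V G → ℕ
degree G v = sum (map ends (edges G))
  where
    ind : V G → ℕ
    ind u = if does ((_≟V_ G) u v) then 1 else 0
    ends : V G × V G → ℕ
    ends (a , b) = ind a + ind b

countDeg : Multigraph → ℕ → ℕ
countDeg G d = length (filterᵇ (λ v → does (degree G v ≟ d)) (vertices G))

-- Voltage graphs over ℤ_m (labels given by natural representatives)

record VoltageGraph : Set where
  field
    n      : ℕ
    pinned : Fin n → Bool
    arcs   : List (Fin n × Fin n × ℕ)   -- arc (v , w , a) : v → w with voltage a

open VoltageGraph public

-- derived vertices: inj₁ v is the single vertex of a pinned v,
-- inj₂ (v , i) is v^i for a non-pinned v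
DVert : VoltageGraph → ℕ → Set
DVert G m = Fin (n G) ⊎ (Fin (n G) × Fin m)

lift : (G : VoltageGraph) (m : ℕ) → Fin (n G) → Fin m → DVert G m
lift G m v i = if pinned G v then inj₁ v else inj₂ (v , i)

derived : (G : VoltageGraph) (m : ℕ) .{{_ : NonZero m}} → Multigraph
derived G m = record
  { V        = DVert G m
  ; _≟V_     = SumP.≡-dec _≟ᶠ_ (ProdP.≡-dec _≟ᶠ_ _≟ᶠ_)
  ; vertices = map inj₁ (filterᵇ (pinned G) (allFin (n G)))
            ++ concatMap (λ v → map (λ i → inj₂ (v , i)) (allFin m))
                         (filterᵇ (λ v → not (pinned G v)) (allFin (n G)))
  ; edges    = concatMap
      (λ { (v , w , a) → map (λ i → lift G m v i , lift G m w ((toℕ i + a) mod m)) (allFin m) })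
      (arcs G)
  }

x* x x0 x1 x01 x10 x11 x010 x011 x100 x101 x110 x111 : Fin 26
x* = # 0
x = # 1
x0 = # 2
x1 = # 3
x01 = # 4
x10 = # 5
x11 = # 6
x010 = # 7
x011 = # 8
x100 = # 9
x101 = # 10
x110 = # 11
x111 = # 12

y* y y0 y1 y01 y10 y11 y010 y011 y100 y101 y110 y111 : Fin 26
y* = # 13
y = # 14
y0 = # 15
y1 = # 16
y01 = # 17
y10 = # 18
y11 = # 19
y010 = # 20
y011 = # 21
y100 = # 22
y101 = # 23
y110 = # 24
y111 = # 25

isPinned : Fin 26 → Bool
isPinned v = does (v ≟ᶠ x*) ∨ does (v ≟ᶠ y*)

G10 : VoltageGraph
G10 = record
  { n = 26
  ; pinned = isPinned
  ; arcs =
      (x* , x , 0) ∷ (x , x0 , 0) ∷ (x , x1 , 0) ∷ (x0 , x01 , 0) ∷ (x1 , x10 , 0) ∷ (x1 , x11 , 0) ∷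
      (x01 , x010 , 0) ∷ (x01 , x011 , 0) ∷ (x10 , x100 , 0) ∷ (x10 , x101 , 0) ∷ (x11 , x110 , 0) ∷ (x11 , x111 , 0) ∷
      (y* , y , 0) ∷ (y , y0 , 0) ∷ (y , y1 , 0) ∷ (y0 , y01 , 0) ∷ (y1 , y10 , 0) ∷ (y1 , y11 , 0) ∷
      (y01 , y010 , 0) ∷ (y01 , y011 , 0) ∷ (y10 , y100 , 0) ∷ (y10 , y101 , 0) ∷ (y11 , y110 , 0) ∷ (y11 , y111 , 0) ∷
      (x0 , y0 , 0) ∷
      (x010 , y010 , 1) ∷ (x010 , y111 , 2) ∷ (x011 , y011 , 2) ∷ (x011 , y110 , 1) ∷
      (x100 , y010 , 2) ∷ (x100 , y101 , 1) ∷ (x101 , y011 , 1) ∷ (x101 , y100 , 2) ∷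
      (x110 , y110 , 2) ∷ (x110 , y111 , 1) ∷ (x111 , y100 , 3) ∷ (x111 , y101 , 0) ∷ []
  }

{-# OPTIONS --safe #-}
-- A cycle of the derived graph projects to a closed walk in G₁₀ that never reverses an
-- arc at an unpinned vertex.  If the cycle avoids x* and y*, the indices i of the lifted
-- vertices v^i force the net voltage of that walk (forward minus backward labels) to vanish
-- modulo m; a cycle through a pinned vertex yields such a walk from that vertex back to
-- itself.  An exhaustive search of the walks of length at most 9 finds none of the second
-- kind and only net voltages ±1, ±2, ±3, ±6 otherwise, none of them divisible by m when
-- m ≥ 4 and m ≠ 6.  The voltage-0 cycle x₁₁₁ y₁₀₁ y₁₀ y₁ y y₀ x₀ x x₁ x₁₁ lifts to a
-- 10-cycle.  Every base vertex other than x*, y* has degree 3 and its m lifts inherit it,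
-- while a pinned vertex is joined to all m lifts of its only neighbour.

module Submission where

open import Defs
open import Data.Bool using (Bool; true; false; not; _∧_; _∨_; _xor_; T; if_then_else_)
open import Data.Bool.ListAction using (all)
open import Data.Bool.Properties using (T-∧; T-∨; T-≡; T-not-≡) renaming (_≟_ to _≟ᴮ_)
open import Data.Empty using (⊥-elim)
open import Data.Fin using (Fin; toℕ; zero; suc; fromℕ<)
open import Data.Fin.Properties using (toℕ-fromℕ<; toℕ-injective; toℕ<n; suc-injective; any?; all?)
  renaming (_≟_ to _≟ᶠ_)
open import Data.List using (List; []; _∷_; _++_; map; concatMap; allFin; tabulate; filterᵇ; length; lookup)
open import Data.List.Properties
  using (map-tabulate; map-∘; map-cong; map-++; length-++; length-map; length-tabulate; filter-++; filter-all; filter-none)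
open import Data.List.Membership.Propositional using (_∈_; find)
open import Data.List.Membership.Propositional.Properties
  using (∈-lookup; ∈-map⁻; ∈-map⁺; ∈-concatMap⁻; ∈-concatMap⁺; ∈-allFin; ∈-filter⁻; ∈-filter⁺; ∈-++⁻)
open import Data.List.Relation.Binary.Disjoint.Propositional using (Disjoint)
open import Data.List.Relation.Unary.All as All using (All; _∷_)
import Data.List.Relation.Unary.All.Properties as All
open import Data.List.Relation.Unary.AllPairs as AllPairs using (AllPairs; _∷_; allPairs?)
import Data.List.Relation.Unary.AllPairs.Properties as AllPairs
open import Data.List.Relation.Unary.Any as Any using (here; there)
open import Data.List.Relation.Unary.Any.Properties using (lookup-index)
open import Data.List.Relation.Unary.Unique.Propositional using (Unique)
open import Data.List.Relation.Unary.Unique.Propositional.Properties using (map⁺; allFin⁺; concat⁺)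
open import Data.Maybe using (Maybe; just; nothing)
open import Data.Nat using (ℕ; zero; suc; _+_; _*_; _∸_; _/_; _%_; _≤_; _<_; _≡ᵇ_; _≟_; NonZero; s≤s; z≤n)
open import Data.Nat.DivMod using (_mod_; m≡m%n+[m/n]*n; [m+kn]%n≡m%n; m<n⇒m%n≡m; m%n<n; m%n≤n)
open import Data.Nat.Divisibility using (_∣_; _∣?_; _∣0; ∣⇒≤; ∣m+n∣m⇒∣n; n∣m*n)
open import Data.Nat.ListAction using (sum)
open import Data.Nat.ListAction.Properties using (sum-++)
open import Data.Nat.Properties
  using (+-assoc; +-comm; +-suc; +-identityʳ; +-cancelʳ-≡; +-cancelˡ-≡; *-zeroʳ; *-identityʳ; *-distribˡ-+;
         m∸n+n≡m; m+[n∸m]≡n; m≤n⇒m∸n≡0; ≤-trans; ≤-total; ≤-pred; <⇒≢; <⇒≱; m<n⇒n≢0; ≡ᵇ⇒≡; ≡⇒≡ᵇ;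
         +-commutativeSemigroup)
open import Data.Nat.Tactic.RingSolver using (solve-∀)
open import Algebra.Properties.CommutativeSemigroup +-commutativeSemigroup
  using (interchange; x∙yz≈xz∙y; xy∙z≈xz∙y)
open import Data.Product using (∃; ∃₂; _×_; _,_; proj₁; proj₂; swap)
open import Data.Product.Properties using () renaming (≡-dec to ×-≡-dec)
open import Data.Sum using (_⊎_; inj₁; inj₂)
open import Data.Vec as Vec using ([]; _∷_)
open import Function using (_∘_; id)
open import Function.Bundles using (Equivalence)
open import Level using (0ℓ)
open import Relation.Binary.Bundles using (Setoid)
open import Relation.Binary.Definitions using (DecidableEquality)
open import Relation.Binary.PropositionalEquality
  using (_≡_; _≢_; refl; sym; trans; cong; cong₂; subst; subst₂; module ≡-Reasoning)
import Relation.Binary.Reasoning.Setoid as SetoidReasoning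
open import Relation.Nullary using (¬_; ¬?; Dec; does; yes; no; _⊎-dec_; _→-dec_)
open import Relation.Nullary.Decidable using (T?; dec-true; dec-false; from-yes; toWitnessFalse)

-- Congruences

infix 4 _≡_[mod_]

_≡_[mod_] : ℕ → ℕ → ℕ → Set
x ≡ y [mod m ] = ∃₂ λ q r → x + q * m ≡ y + r * m

private
  +-*-regroup : ∀ x q r m → x + (q + r) * m ≡ x + q * m + r * m
  +-*-regroup = solve-∀

  +-*-swap : ∀ x q r m → x + q * m + r * m ≡ x + r * m + q * m
  +-*-swap = solve-∀

  +-*-shuffle : ∀ x c q m → x + c + q * m ≡ x + q * m + c
  +-*-shuffle = solve-∀

module _ {m : ℕ} where

  ≡[mod]-refl : ∀ {x} → x ≡ x [mod m ]
  ≡[mod]-refl = 0 , 0 , refl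

  ≡[mod]-sym : ∀ {x y} → x ≡ y [mod m ] → y ≡ x [mod m ]
  ≡[mod]-sym (q , r , eq) = r , q , sym eq

  ≡[mod]-trans : ∀ {x y z} → x ≡ y [mod m ] → y ≡ z [mod m ] → x ≡ z [mod m ]
  ≡[mod]-trans {x} {y} {z} (q , r , x≈y) (q′ , r′ , y≈z) = q + q′ , r′ + r , (begin
    x + (q + q′) * m      ≡⟨ +-*-regroup x q q′ m ⟩
    x + q * m + q′ * m    ≡⟨ cong (_+ q′ * m) x≈y ⟩
    y + r * m + q′ * m    ≡⟨ +-*-swap y r q′ m ⟩
    y + q′ * m + r * m    ≡⟨ cong (_+ r * m) y≈z ⟩
    z + r′ * m + r * m    ≡⟨ sym (+-*-regroup z r′ r m) ⟩
    z + (r′ + r) * m      ∎)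
    where open ≡-Reasoning

  +-congʳ-[mod] : ∀ {x y} c → x ≡ y [mod m ] → x + c ≡ y + c [mod m ]
  +-congʳ-[mod] {x} {y} c (q , r , eq) = q , r , (begin
    x + c + q * m    ≡⟨ +-*-shuffle x c q m ⟩
    x + q * m + c    ≡⟨ cong (_+ c) eq ⟩
    y + r * m + c    ≡⟨ sym (+-*-shuffle y c r m) ⟩
    y + c + r * m    ∎)
    where open ≡-Reasoning

  +-congˡ-[mod] : ∀ {x y} c → x ≡ y [mod m ] → c + x ≡ c + y [mod m ]
  +-congˡ-[mod] {x} {y} c x≈y =
    subst₂ (_≡_[mod m ]) (+-comm x c) (+-comm y c) (+-congʳ-[mod] c x≈y)

  +-cancelʳ-[mod] : ∀ {x y} c → x + c ≡ y + c [mod m ] → x ≡ y [mod m ]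
  +-cancelʳ-[mod] {x} {y} c (q , r , eq) = q , r , +-cancelʳ-≡ c _ _ (begin
    x + q * m + c    ≡⟨ sym (+-*-shuffle x c q m) ⟩
    x + c + q * m    ≡⟨ eq ⟩
    y + c + r * m    ≡⟨ +-*-shuffle y c r m ⟩
    y + r * m + c    ∎)
    where open ≡-Reasoning

  +-cancelˡ-[mod] : ∀ {x y} c → c + x ≡ c + y [mod m ] → x ≡ y [mod m ]
  +-cancelˡ-[mod] {x} {y} c c+x≈c+y =
    +-cancelʳ-[mod] c (subst₂ (_≡_[mod m ]) (+-comm c x) (+-comm c y) c+x≈c+y)

  +-period-[mod] : ∀ x → x + m ≡ x [mod m ]
  +-period-[mod] x = 0 , 1 , x+m+0*m≡x+1*m x m
    where
      x+m+0*m≡x+1*m : ∀ x m → x + m + 0 * m ≡ x + 1 * m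
      x+m+0*m≡x+1*m = solve-∀

  ≡[mod]⇒∣ : ∀ {x d} → x ≡ x + d [mod m ] → m ∣ d
  ≡[mod]⇒∣ {x} {d} (q , r , eq) = ∣m+n∣m⇒∣n (subst (m ∣_) q*m≡r*m+d (n∣m*n q)) (n∣m*n r)
    where
      reassociate : ∀ x d r m → x + d + r * m ≡ x + (r * m + d)
      reassociate = solve-∀
      q*m≡r*m+d : q * m ≡ r * m + d
      q*m≡r*m+d = +-cancelˡ-≡ x _ _ (trans eq (reassociate x d r m))

≡[mod]-setoid : ℕ → Setoid 0ℓ 0ℓ
≡[mod]-setoid m = record
  { Carrier = ℕ
  ; _≈_ = _≡_[mod m ]
  ; isEquivalence = record { refl = ≡[mod]-refl ; sym = ≡[mod]-sym ; trans = ≡[mod]-trans }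
  }

module ≡[mod]-Reasoning (m : ℕ) = SetoidReasoning (≡[mod]-setoid m)

≡[mod]⇒∣∸ : ∀ {m x y} → x ≡ y [mod m ] → m ∣ y ∸ x
≡[mod]⇒∣∸ {m} {x} {y} x≈y with ≤-total x y
... | inj₁ x≤y = ≡[mod]⇒∣ (subst (x ≡_[mod m ]) (sym (m+[n∸m]≡n x≤y)) x≈y)
... | inj₂ y≤x = subst (m ∣_) (sym (m≤n⇒m∸n≡0 y≤x)) (m ∣0)

module _ {m : ℕ} .{{_ : NonZero m}} where

  %-≡[mod] : ∀ x → x % m ≡ x [mod m ]
  %-≡[mod] x = x / m , 0 , trans (sym (m≡m%n+[m/n]*n x m)) (sym (+-identityʳ x))

  ≡[mod]⇒%≡ : ∀ {x y} → x ≡ y [mod m ] → x % m ≡ y % m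
  ≡[mod]⇒%≡ {x} {y} (q , r , eq) = begin
    x % m            ≡⟨ sym ([m+kn]%n≡m%n x q m) ⟩
    (x + q * m) % m  ≡⟨ cong (_% m) eq ⟩
    (y + r * m) % m  ≡⟨ [m+kn]%n≡m%n y r m ⟩
    y % m            ∎
    where open ≡-Reasoning

  ≡[mod]⇒≡ : ∀ {x y} → x ≡ y [mod m ] → x < m → y < m → x ≡ y
  ≡[mod]⇒≡ x≈y x<m y<m = trans (sym (m<n⇒m%n≡m x<m)) (trans (≡[mod]⇒%≡ x≈y) (m<n⇒m%n≡m y<m))

  toℕ-mod : ∀ x → toℕ (x mod m) ≡ x [mod m ]
  toℕ-mod x = subst (_≡ x [mod m ]) (sym (toℕ-fromℕ< (m%n<n x m))) (%-≡[mod] x)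

module _ {m : ℕ} .{{_ : NonZero m}} where

  shift : ℕ → Fin m → Fin m
  shift a j = (toℕ j + a) mod m

  toℕ-shift : ∀ a j → toℕ (shift a j) ≡ toℕ j + a [mod m ]
  toℕ-shift a j = toℕ-mod (toℕ j + a)

  shift-injective : ∀ a {i j} → shift a i ≡ shift a j → i ≡ j
  shift-injective a {i} {j} eq = toℕ-injective (≡[mod]⇒≡ (+-cancelʳ-[mod] a i+a≈j+a) (toℕ<n i) (toℕ<n j))
    where
      open ≡[mod]-Reasoning m
      i+a≈j+a : toℕ i + a ≡ toℕ j + a [mod m ]
      i+a≈j+a = begin
        toℕ i + a          ≈⟨ toℕ-shift a i ⟨
        toℕ (shift a i)    ≡⟨ cong toℕ eq ⟩
        toℕ (shift a j)    ≈⟨ toℕ-shift a j ⟩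
        toℕ j + a          ∎

  shift-surjective : ∀ a i → ∃ λ j → shift a j ≡ i
  shift-surjective a i = j , toℕ-injective (≡[mod]⇒≡ j+a≈i (toℕ<n (shift a j)) (toℕ<n i))
    where
      open ≡[mod]-Reasoning m
      c = m ∸ a % m
      j = (toℕ i + c) mod m
      j+a≈i : toℕ (shift a j) ≡ toℕ i [mod m ]
      j+a≈i = begin
        toℕ (shift a j)      ≈⟨ toℕ-shift a j ⟩
        toℕ j + a            ≈⟨ +-congʳ-[mod] a (toℕ-mod (toℕ i + c)) ⟩
        toℕ i + c + a        ≈⟨ +-congˡ-[mod] (toℕ i + c) (%-≡[mod] a) ⟨
        toℕ i + c + a % m    ≡⟨ +-assoc (toℕ i) c (a % m) ⟩
        toℕ i + (c + a % m)  ≡⟨ cong (toℕ i +_) (m∸n+n≡m (m%n≤n a m)) ⟩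
        toℕ i + m            ≈⟨ +-period-[mod] (toℕ i) ⟩
        toℕ i                ∎

  shift-zero : ∀ j → shift 0 j ≡ j
  shift-zero j = toℕ-injective (≡[mod]⇒≡ j+0≈j (toℕ<n (shift 0 j)) (toℕ<n j))
    where
      j+0≈j : toℕ (shift 0 j) ≡ toℕ j [mod m ]
      j+0≈j = subst (toℕ (shift 0 j) ≡_[mod m ]) (+-identityʳ (toℕ j)) (toℕ-shift 0 j)

module _ {k : ℕ} where

  toℕ-csuc : ∀ (i : Fin (suc k)) → toℕ (csuc i) ≡ 1 + toℕ i [mod suc k ]
  toℕ-csuc i = toℕ-mod (suc (toℕ i))

  advance : Fin (suc k) → ℕ → Fin (suc k)
  advance i zero = i
  advance i (suc t) = csuc (advance i t)

  toℕ-advance : ∀ i t → toℕ (advance i t) ≡ toℕ i + t [mod suc k ]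
  toℕ-advance i zero = subst (toℕ i ≡_[mod suc k ]) (sym (+-identityʳ (toℕ i))) ≡[mod]-refl
  toℕ-advance i (suc t) = begin
    toℕ (csuc (advance i t))  ≈⟨ toℕ-csuc (advance i t) ⟩
    1 + toℕ (advance i t)     ≈⟨ +-congˡ-[mod] 1 (toℕ-advance i t) ⟩
    suc (toℕ i + t)           ≡⟨ sym (+-suc (toℕ i) t) ⟩
    toℕ i + suc t             ∎
    where open ≡[mod]-Reasoning (suc k)

  advance-period : ∀ i → advance i (suc k) ≡ i
  advance-period i = toℕ-injective (≡[mod]⇒≡
    (≡[mod]-trans (toℕ-advance i (suc k)) (+-period-[mod] (toℕ i))) (toℕ<n (advance i (suc k))) (toℕ<n i))

csuc-fixed⇒k≡0 : ∀ {k} (i : Fin (suc k)) → csuc i ≡ i → k ≡ 0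
csuc-fixed⇒k≡0 {zero} _ _ = refl
-- The final absurd pattern works because 1 % (2 + k) and 0 % (2 + k) compute to 1 and 0.
csuc-fixed⇒k≡0 {suc k} i eq with ≡[mod]⇒%≡ (+-cancelʳ-[mod] (toℕ i) 1+i≈0+i)
  where
    open ≡[mod]-Reasoning (2 + k)
    1+i≈0+i : 1 + toℕ i ≡ 0 + toℕ i [mod 2 + k ]
    1+i≈0+i = begin
      1 + toℕ i       ≈⟨ toℕ-csuc i ⟨
      toℕ (csuc i)    ≡⟨ cong toℕ eq ⟩
      toℕ i           ∎
... | ()

≡ᵇ-refl : ∀ x → (x ≡ᵇ x) ≡ true
≡ᵇ-refl x = Equivalence.to T-≡ (≡⇒≡ᵇ x x refl)

Unique⇒lookup-injective : ∀ {A : Set} {xs : List A} → Unique xs → ∀ i j → lookup xs i ≡ lookup xs j → i ≡ j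
Unique⇒lookup-injective (_ ∷ _) zero zero _ = refl
Unique⇒lookup-injective (x∉xs ∷ _) zero (suc j) eq = ⊥-elim (All.lookup x∉xs (∈-lookup j) eq)
Unique⇒lookup-injective (x∉xs ∷ _) (suc i) zero eq = ⊥-elim (All.lookup x∉xs (∈-lookup i) (sym eq))
Unique⇒lookup-injective (_ ∷ xs!) (suc i) (suc j) eq = cong suc (Unique⇒lookup-injective xs! i j eq)

indicator : ∀ {P : Set} → Dec P → ℕ
indicator p = if does p then 1 else 0

indicator-yes : ∀ {P : Set} (p : Dec P) → P → indicator p ≡ 1
indicator-yes p x = cong (λ b → if b then 1 else 0) (dec-true p x)

indicator-no : ∀ {P : Set} (p : Dec P) → ¬ P → indicator p ≡ 0
indicator-no p ¬x = cong (λ b → if b then 1 else 0) (dec-false p ¬x)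

module _ {A B : Set} where

  sum-map-concatMap : ∀ (f : B → ℕ) (g : A → List B) xs →
                      sum (map f (concatMap g xs)) ≡ sum (map (sum ∘ map f ∘ g) xs)
  sum-map-concatMap f g [] = refl
  sum-map-concatMap f g (x ∷ xs) = begin
    sum (map f (g x ++ concatMap g xs))          ≡⟨ cong sum (map-++ f (g x) _) ⟩
    sum (map f (g x) ++ map f (concatMap g xs))  ≡⟨ sum-++ (map f (g x)) _ ⟩
    sum (map f (g x)) + sum (map f (concatMap g xs))       ≡⟨ cong (sum (map f (g x)) +_) (sum-map-concatMap f g xs) ⟩
    sum (map f (g x)) + sum (map (sum ∘ map f ∘ g) xs)     ∎
    where open ≡-Reasoning

module _ {A : Set} where

  sum-map-+ : ∀ (f g : A → ℕ) xs → sum (map (λ x → f x + g x) xs) ≡ sum (map f xs) + sum (map g xs)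
  sum-map-+ f g [] = refl
  sum-map-+ f g (x ∷ xs) = trans (cong (f x + g x +_) (sum-map-+ f g xs)) (interchange (f x) (g x) _ _)

  sum-map-*ˡ : ∀ c (f : A → ℕ) xs → sum (map (λ x → c * f x) xs) ≡ c * sum (map f xs)
  sum-map-*ˡ c f [] = sym (*-zeroʳ c)
  sum-map-*ˡ c f (x ∷ xs) = trans (cong (c * f x +_) (sum-map-*ˡ c f xs)) (sym (*-distribˡ-+ c (f x) _))

sum-allFin : ∀ {n} (f : Fin n → ℕ) → sum (map f (allFin n)) ≡ sum (tabulate f)
sum-allFin f = cong sum (map-tabulate id f)

sum-tabulate-const : ∀ {n} (f : Fin n → ℕ) {c} → (∀ j → f j ≡ c) → sum (tabulate f) ≡ n * c
sum-tabulate-const {zero} f const = refl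
sum-tabulate-const {suc n} f const = cong₂ _+_ (const zero) (sum-tabulate-const (f ∘ suc) (const ∘ suc))

sum-tabulate-delta : ∀ {n} (f : Fin n → ℕ) i → f i ≡ 1 → (∀ j → j ≢ i → f j ≡ 0) → sum (tabulate f) ≡ 1
sum-tabulate-delta {suc n} f zero fi≡1 others =
  cong₂ _+_ fi≡1 (trans (sum-tabulate-const (f ∘ suc) (λ j → others (suc j) λ ())) (*-zeroʳ n))
sum-tabulate-delta {suc n} f (suc i) fi≡1 others =
  cong₂ _+_ (others zero λ ()) (sum-tabulate-delta (f ∘ suc) i fi≡1 λ j j≢i → others (suc j) (j≢i ∘ suc-injective))

length-filterᵇ-all : ∀ {A : Set} (p : A → Bool) xs → (∀ x → x ∈ xs → T (p x)) → length (filterᵇ p xs) ≡ length xs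
length-filterᵇ-all p xs all-p = cong length (filter-all (T? ∘ p) (All.tabulate (all-p _)))

length-filterᵇ-none : ∀ {A : Set} (p : A → Bool) xs → (∀ x → x ∈ xs → ¬ T (p x)) → length (filterᵇ p xs) ≡ 0
length-filterᵇ-none p xs none-p = cong length (filter-none (T? ∘ p) (All.tabulate (none-p _)))

length-concatMap-const : ∀ {A B : Set} (f : A → List B) c xs → (∀ x → length (f x) ≡ c) → length (concatMap f xs) ≡ length xs * c
length-concatMap-const f c [] _ = refl
length-concatMap-const f c (x ∷ xs) len = trans (length-++ (f x)) (cong₂ _+_ (len x) (length-concatMap-const f c xs len))

injective? : ∀ {A : Set} {k} → DecidableEquality A → (f : Fin k → A) → Dec (∀ i j → f i ≡ f j → i ≡ j)
injective? _≟ᴬ_ f = all? λ i → all? λ j → (f i ≟ᴬ f j) →-dec (i ≟ᶠ j)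

-- Darts and the search for short closed walks

Arc : Set → Set
Arc V = V × V × ℕ

-- (true , arc) traverses arc from its tail to its head, (false , arc) in the opposite direction.
Dart : Set → Set
Dart V = Bool × Arc V

module _ {V : Set} where

  tail head : Dart V → V
  tail (true , v , w , a) = v
  tail (false , v , w , a) = w
  head (true , v , w , a) = w
  head (false , v , w , a) = v

  forwardVoltage backwardVoltage : Dart V → ℕ
  forwardVoltage (s , v , w , a) = if s then a else 0
  backwardVoltage (s , v , w , a) = if s then 0 else a

  bothDarts : Arc V → List (Dart V)
  bothDarts arc = (true , arc) ∷ (false , arc) ∷ []

endpoints : ∀ {V : Set} → Arc V → V × V
endpoints (v , w , a) = v , w

voltage : ∀ {V : Set} → Arc V → ℕ
voltage (_ , _ , a) = a

dartsAt : List (Arc ℕ) → ℕ → List (Dart ℕ)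
dartsAt arcs u = filterᵇ (λ d → tail d ≡ᵇ u) (concatMap bothDarts arcs)

_≡ᵃ_ : Arc ℕ → Arc ℕ → Bool
(v , w , a) ≡ᵃ (v′ , w′ , a′) = (v ≡ᵇ v′) ∧ (w ≡ᵇ w′) ∧ (a ≡ᵇ a′)

≡ᵃ⇒≡ : ∀ arc arc′ → T (arc ≡ᵃ arc′) → arc ≡ arc′
≡ᵃ⇒≡ (v , w , a) (v′ , w′ , a′) eq =
  let v≡ , eq′ = ∧-elim eq; w≡ , a≡ = ∧-elim eq′
  in cong₂ _,_ (≡ᵇ⇒≡ v v′ v≡) (cong₂ _,_ (≡ᵇ⇒≡ w w′ w≡) (≡ᵇ⇒≡ a a′ a≡))
  where
    ∧-elim : ∀ {x y} → T (x ∧ y) → T x × T y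
    ∧-elim = Equivalence.to T-∧

reverses : Maybe (Dart ℕ) → Dart ℕ → Bool
reverses nothing _ = false
reverses (just (s , arc)) (s′ , arc′) = (s xor s′) ∧ (arc ≡ᵃ arc′)

reverses-sound : ∀ d d′ → T (reverses (just d) d′) → d′ ≡ (not (proj₁ d) , proj₂ d)
reverses-sound (true , arc) (false , arc′) rev = cong (false ,_) (sym (≡ᵃ⇒≡ arc arc′ rev))
reverses-sound (false , arc) (true , arc′) rev = cong (true ,_) (sym (≡ᵃ⇒≡ arc arc′ rev))
reverses-sound (true , _) (true , _) ()
reverses-sound (false , _) (false , _) ()

-- The search runs on vertices coded by toℕ, so that it compares builtin naturals.
codeArc : ∀ {n} → Arc (Fin n) → Arc ℕ
codeArc (v , w , a) = toℕ v , toℕ w , a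

codeArc-injective : ∀ {n} {arc arc′ : Arc (Fin n)} → codeArc arc ≡ codeArc arc′ → arc ≡ arc′
codeArc-injective {arc = _ , _ , _} {_ , _ , _} eq =
  cong₂ _,_ (toℕ-injective (cong proj₁ eq)) (cong₂ _,_ (toℕ-injective (cong (proj₁ ∘ proj₂) eq)) (cong (proj₂ ∘ proj₂) eq))

codeDart : ∀ {n} → Dart (Fin n) → Dart ℕ
codeDart (s , arc) = s , codeArc arc

codeDart-injective : ∀ {n} {d d′ : Dart (Fin n)} → codeDart d ≡ codeDart d′ → d ≡ d′
codeDart-injective {d = _ , _} {_ , _} eq = cong₂ _,_ (cong proj₁ eq) (codeArc-injective (cong proj₂ eq))

tail-codeDart : ∀ {n} (d : Dart (Fin n)) → tail (codeDart d) ≡ toℕ (tail d)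
tail-codeDart (true , _) = refl
tail-codeDart (false , _) = refl

head-codeDart : ∀ {n} (d : Dart (Fin n)) → head (codeDart d) ≡ toℕ (head d)
head-codeDart (true , _) = refl
head-codeDart (false , _) = refl

codeDart-listed : ∀ {n} {arcs : List (Arc (Fin n))} (d : Dart (Fin n)) → proj₂ d ∈ arcs →
                  codeDart d ∈ dartsAt (map codeArc arcs) (toℕ (tail d))
codeDart-listed d@(s , arc) arc∈ = ∈-filter⁺ (λ d′ → T? (tail d′ ≡ᵇ toℕ (tail d)))
  (∈-concatMap⁺ bothDarts (Any.map (λ { refl → dart∈both s }) (∈-map⁺ codeArc arc∈)))
  (≡⇒≡ᵇ _ _ (tail-codeDart d))
  where
    dart∈both : ∀ s → (s , codeArc arc) ∈ bothDarts (codeArc arc)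
    dart∈both true = here refl
    dart∈both false = there (here refl)

module Search (pinned : ℕ → Bool) (arcs : List (Arc ℕ)) (good : ℕ → ℕ → Bool) where

  record Walker : Set where
    constructor walker
    field
      position : ℕ
      forward backward : ℕ
      lastDart : Maybe (Dart ℕ)

  open Walker public

  step : Walker → Dart ℕ → Walker
  step w d = walker (head d) (forward w + forwardVoltage d) (backward w + backwardVoltage d) (just d)

  backtracks : Walker → Dart ℕ → Bool
  backtracks w d = not (pinned (position w)) ∧ reverses (lastDart w) d

  backtracks-start : ∀ b d → ¬ T (backtracks (walker b 0 0 nothing) d)
  backtracks-start b d back = proj₂ (Equivalence.to T-∧ back)

  backtracks-sound : ∀ w d₀ d → T (backtracks (step w d₀) d) → pinned (head d₀) ≡ false × d ≡ (not (proj₁ d₀) , proj₂ d₀)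
  backtracks-sound w d₀ d back with Equivalence.to T-∧ back
  ... | unpinned , rev = Equivalence.to T-not-≡ unpinned , reverses-sound d₀ d rev

  walk : Walker → (ℕ → Dart ℕ) → ℕ → Walker
  walk w ds zero = w
  walk w ds (suc t) = step (walk w ds t) (ds t)

  walk-shift : ∀ w ds t → walk w ds (suc t) ≡ walk (step w (ds 0)) (ds ∘ suc) t
  walk-shift w ds zero = refl
  walk-shift w ds (suc t) = cong (λ w′ → step w′ (ds (suc t))) (walk-shift w ds t)

  module _ (b : ℕ) where

    start : Walker
    start = walker b 0 0 nothing

    -- A return to b is harmless only if b is unpinned and good certifies the net voltage
    -- nonzero: a pinned b is joined to every lift of its neighbour.
    closes : Walker → Bool
    closes w = not (position w ≡ᵇ b) ∨ (not (pinned b) ∧ good (forward w) (backward w))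

    halts : Walker → Bool
    halts w = not (pinned b) ∧ pinned (position w)

    explore : ℕ → Walker → Bool
    explore zero w = true
    explore (suc k) w = halts w ∨ all continues (dartsAt arcs (position w))
      where
        continues : Dart ℕ → Bool
        continues d = backtracks w d ∨ (closes (step w d) ∧ explore k (step w d))

    halts-pinned : pinned b ≡ true → ∀ w → ¬ T (halts w)
    halts-pinned p w rewrite p = λ ()

    halts-unpinned : ∀ w → pinned (position w) ≡ false → ¬ T (halts w)
    halts-unpinned w p rewrite p = λ h → proj₂ (Equivalence.to T-∧ h)

    closes-pinned : pinned b ≡ true → ∀ w → position w ≡ b → ¬ T (closes w)
    closes-pinned p w refl rewrite p | ≡ᵇ-refl (position w) = λ ()

    closes⇒good : ∀ w → position w ≡ b → T (closes w) → T (good (forward w) (backward w))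
    closes⇒good w refl c rewrite ≡ᵇ-refl (position w) = proj₂ (Equivalence.to T-∧ c)

    Admissible : Walker → Dart ℕ → Set
    Admissible w d = ¬ T (halts w) × d ∈ dartsAt arcs (position w) × ¬ T (backtracks w d)

    explore-sound : ∀ k w ds u → u < k → T (explore k w) →
                    (∀ t → t ≤ u → Admissible (walk w ds t) (ds t)) →
                    T (closes (walk w ds (suc u)))
    explore-sound (suc k) w ds u (s≤s u≤k) ex admissible
      with ¬halts , d∈ , ¬back ← admissible 0 z≤n
      with Equivalence.to T-∨ ex
    ... | inj₁ h = ⊥-elim (¬halts h)
    ... | inj₂ all-continue with Equivalence.to T-∨ (All.lookup (All.all⁺ _ _ all-continue) d∈)
    ...   | inj₁ back = ⊥-elim (¬back back)
    ...   | inj₂ cont = continue u u≤k (Equivalence.to T-∧ cont) admissible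
      where
        continue : ∀ u → u ≤ k → T (closes (step w (ds 0))) × T (explore k (step w (ds 0))) →
                   (∀ t → t ≤ u → Admissible (walk w ds t) (ds t)) →
                   T (closes (walk w ds (suc u)))
        continue zero _ (closes-next , _) _ = closes-next
        continue (suc u′) u<k (_ , ex′) admissible′ = subst (T ∘ closes) (sym (walk-shift w ds (suc u′)))
          (explore-sound k (step w (ds 0)) (ds ∘ suc) u′ u<k ex′
            λ t t≤u′ → subst (λ w′ → Admissible w′ (ds (suc t))) (walk-shift w ds t) (admissible′ (suc t) (s≤s t≤u′)))

module Derived (G : VoltageGraph) (m : ℕ) .{{_ : NonZero m}} where

  D : Multigraph
  D = derived G m

  Vertex : Set
  Vertex = DVert G m

  base : Vertex → Fin (n G)
  base (inj₁ v) = v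
  base (inj₂ (v , _)) = v

  base-lift : ∀ v i → base (lift G m v i) ≡ v
  base-lift v i with pinned G v
  ... | true = refl
  ... | false = refl

  lift-pinned : ∀ {v} i → pinned G v ≡ true → lift G m v i ≡ inj₁ v
  lift-pinned i p rewrite p = refl

  lift-unpinned : ∀ {v} i → pinned G v ≡ false → lift G m v i ≡ inj₂ (v , i)
  lift-unpinned i p rewrite p = refl

  lift≡inj₁⇒pinned : ∀ {v i u} → lift G m v i ≡ inj₁ u → pinned G v ≡ true
  lift≡inj₁⇒pinned {v} eq with pinned G v
  ... | true = refl
  lift≡inj₁⇒pinned () | false

  lift≡inj₂⇒unpinned : ∀ {v i u j} → lift G m v i ≡ inj₂ (u , j) → pinned G v ≡ false × i ≡ j
  lift≡inj₂⇒unpinned {v} eq with pinned G v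
  lift≡inj₂⇒unpinned () | true
  lift≡inj₂⇒unpinned refl | false = refl , refl

  lift-injective : ∀ {v i j} → pinned G v ≡ false → lift G m v i ≡ lift G m v j → i ≡ j
  lift-injective {j = j} p eq = proj₂ (lift≡inj₂⇒unpinned (trans eq (lift-unpinned j p)))

  arcEdge : Arc (Fin (n G)) → Fin m → Vertex × Vertex
  arcEdge (v , w , a) j = lift G m v j , lift G m w (shift a j)

  arcEdges : Arc (Fin (n G)) → List (Vertex × Vertex)
  arcEdges arc = map (arcEdge arc) (allFin m)

  baseEdge : Vertex × Vertex → Fin (n G) × Fin (n G)
  baseEdge (x , y) = base x , base y

  baseEdge-arcEdge : ∀ arc j → baseEdge (arcEdge arc j) ≡ endpoints arc
  baseEdge-arcEdge (v , w , a) j = cong₂ _,_ (base-lift v j) (base-lift w (shift a j))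

  edge-origin : (e : EdgeIx D) → ∃₂ λ arc j → arc ∈ arcs G × edgeAt D e ≡ arcEdge arc j
  edge-origin e with find (∈-concatMap⁻ arcEdges {xs = arcs G} (∈-lookup e))
  ... | arc , arc∈ , e∈ with ∈-map⁻ (arcEdge arc) e∈
  ... | j , _ , eq = arc , j , arc∈ , eq

  edge-of-arc : ∀ {arc} → arc ∈ arcs G → ∀ j → ∃ λ (e : EdgeIx D) → edgeAt D e ≡ arcEdge arc j
  edge-of-arc {arc} arc∈ j = Any.index e∈ , sym (lookup-index e∈)
    where e∈ = ∈-concatMap⁺ arcEdges (Any.map (λ { refl → ∈-map⁺ (arcEdge arc) (∈-allFin j) }) arc∈)

  NotBothPinned : Arc (Fin (n G)) → Set
  NotBothPinned (v , w , a) = pinned G v ≡ false ⊎ pinned G w ≡ false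

  arcEdge-injective : ∀ arc → NotBothPinned arc → ∀ {i j} → arcEdge arc i ≡ arcEdge arc j → i ≡ j
  arcEdge-injective (v , w , a) (inj₁ p) eq = lift-injective p (cong proj₁ eq)
  arcEdge-injective (v , w , a) (inj₂ p) eq = shift-injective a (lift-injective p (cong proj₂ eq))

  arcEdges-disjoint : ∀ arc arc′ → endpoints arc ≢ endpoints arc′ → Disjoint (arcEdges arc) (arcEdges arc′)
  arcEdges-disjoint arc arc′ ≢ (x∈ , x∈′) with ∈-map⁻ (arcEdge arc) x∈ | ∈-map⁻ (arcEdge arc′) x∈′
  ... | j , _ , refl | j′ , _ , eq = ≢ (trans (sym (baseEdge-arcEdge arc j)) (trans (cong baseEdge eq) (baseEdge-arcEdge arc′ j′)))

  edges-unique : All NotBothPinned (arcs G) →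
                 AllPairs (λ arc arc′ → endpoints arc ≢ endpoints arc′) (arcs G) →
                 Unique (edges D)
  edges-unique notBoth distinct = concat⁺
    (All.map⁺ (All.map (λ {arc} nb → map⁺ (arcEdge-injective arc nb) (allFin⁺ m)) notBoth))
    (AllPairs.map⁺ (AllPairs.map (λ {arc} {arc′} → arcEdges-disjoint arc arc′) distinct))

  orient : Bool → Vertex × Vertex → Vertex × Vertex
  orient true e = e
  orient false (x , y) = y , x

  dartEnds : Dart (Fin (n G)) → Fin m → Vertex × Vertex
  dartEnds (s , arc) j = orient s (arcEdge arc j)

  dartEnds-tail : ∀ d j → ∃ λ i → proj₁ (dartEnds d j) ≡ lift G m (tail d) i
  dartEnds-tail (true , v , w , a) j = j , refl
  dartEnds-tail (false , v , w , a) j = shift a j , refl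

  dartEnds-head : ∀ d j → ∃ λ i → proj₂ (dartEnds d j) ≡ lift G m (head d) i
  dartEnds-head (true , v , w , a) j = shift a j , refl
  dartEnds-head (false , v , w , a) j = j , refl

  reversal-same-index : ∀ s arc {j j′} → pinned G (head (s , arc)) ≡ false →
                        proj₂ (dartEnds (s , arc) j) ≡ proj₁ (dartEnds (not s , arc) j′) → j ≡ j′
  reversal-same-index true (v , w , a) p eq = shift-injective a (lift-injective p eq)
  reversal-same-index false (v , w , a) p eq = lift-injective p eq

  -- The index i of v^i; pinned vertices get the junk value 0.
  level : Vertex → ℕ
  level (inj₁ _) = 0
  level (inj₂ (_ , i)) = toℕ i

  lift≢inj₁⇒unpinned : ∀ {v i} → lift G m v i ≢ inj₁ v → pinned G v ≡ false
  lift≢inj₁⇒unpinned {v} {i} ≢ with pinned G v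
  ... | true = ⊥-elim (≢ refl)
  ... | false = refl

  level-lift : ∀ {v} i → pinned G v ≡ false → level (lift G m v i) ≡ toℕ i
  level-lift i p rewrite p = refl

  level-dartEnds : ∀ d j → (∀ u → proj₁ (dartEnds d j) ≢ inj₁ u) → (∀ u → proj₂ (dartEnds d j) ≢ inj₁ u) →
                   level (proj₂ (dartEnds d j)) + backwardVoltage d ≡ level (proj₁ (dartEnds d j)) + forwardVoltage d [mod m ]
  level-dartEnds (true , v , w , a) j ≢₁ ≢₂
    rewrite level-lift j (lift≢inj₁⇒unpinned (≢₁ v)) | level-lift (shift a j) (lift≢inj₁⇒unpinned (≢₂ w))
          | +-identityʳ (toℕ (shift a j)) = toℕ-shift a j
  level-dartEnds (false , v , w , a) j ≢₁ ≢₂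
    rewrite level-lift j (lift≢inj₁⇒unpinned (≢₂ v)) | level-lift (shift a j) (lift≢inj₁⇒unpinned (≢₁ w))
          | +-identityʳ (toℕ (shift a j)) = ≡[mod]-sym (toℕ-shift a j)

-- Short cycles

module ShortCycles (G : VoltageGraph) (m : ℕ) .{{_ : NonZero m}}
    (pinnedᶜ : ℕ → Bool) (pinnedᶜ-toℕ : ∀ v → pinnedᶜ (toℕ v) ≡ pinned G v)
    (good : ℕ → ℕ → Bool) (good-sound : ∀ {P N} → T (good P N) → ¬ N ≡ P [mod m ])
    (edges! : Unique (edges (derived G m))) where

  open Derived G m
  open Search pinnedᶜ (map codeArc (arcs G)) good

  module ClosedWalk {k} (C : Cycle D (suc k)) (r : Fin (suc k)) where
    open Cycle C

    W : ℕ → Vertex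
    W t = vert (advance r t)

    record Traversal (t : ℕ) : Set where
      field
        dart : Dart (Fin (n G))
        index : Fin m
        arc∈ : proj₂ dart ∈ arcs G
        edge≡ : edgeAt D (edge (advance r t)) ≡ arcEdge (proj₂ dart) index
        ends≡ : dartEnds dart index ≡ (W t , W (suc t))

    -- Kept abstract: only the fields of a traversal matter, and unfolding the edge lookup is expensive.
    abstract
     traversal : ∀ t → Traversal t
     traversal t with edge-origin (edge (advance r t)) | joins (advance r t)
     ... | arc , j , arc∈ , eq | inj₁ (e₁ , e₂) = record
       { dart = true , arc ; index = j ; arc∈ = arc∈ ; edge≡ = eq ; ends≡ = trans (sym eq) (cong₂ _,_ e₁ e₂) }
     ... | arc , j , arc∈ , eq | inj₂ (e₁ , e₂) = record
       { dart = false , arc ; index = j ; arc∈ = arc∈ ; edge≡ = eq ; ends≡ = cong swap (trans (sym eq) (cong₂ _,_ e₁ e₂)) }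

    open Traversal

    darts : ℕ → Dart ℕ
    darts t = codeDart (dart (traversal t))

    b : ℕ
    b = toℕ (base (W 0))

    trace : ℕ → Walker
    trace = walk (start b) darts

    W-tail : ∀ t → ∃ λ i → W t ≡ lift G m (tail (dart (traversal t))) i
    W-tail t = proj₁ ends , trans (sym (cong proj₁ (ends≡ (traversal t)))) (proj₂ ends)
      where ends = dartEnds-tail (dart (traversal t)) (index (traversal t))

    W-head : ∀ t → ∃ λ i → W (suc t) ≡ lift G m (head (dart (traversal t))) i
    W-head t = proj₁ ends , trans (sym (cong proj₂ (ends≡ (traversal t)))) (proj₂ ends)
      where ends = dartEnds-head (dart (traversal t)) (index (traversal t))

    base-W-tail : ∀ t → base (W t) ≡ tail (dart (traversal t))
    base-W-tail t = trans (cong base (proj₂ (W-tail t))) (base-lift _ _)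

    base-W-head : ∀ t → base (W (suc t)) ≡ head (dart (traversal t))
    base-W-head t = trans (cong base (proj₂ (W-head t))) (base-lift _ _)

    pinned-W : ∀ t u → W t ≡ inj₁ u → pinned G (base (W t)) ≡ true
    pinned-W t u eq = trans (cong (pinned G) (base-W-tail t))
      (lift≡inj₁⇒pinned (trans (sym (proj₂ (W-tail t))) eq))

    unpinned-W : ∀ t → (∀ u → W t ≢ inj₁ u) → pinned G (base (W t)) ≡ false
    unpinned-W t avoids = trans (cong (pinned G) (base-W-tail t))
      (lift≢inj₁⇒unpinned λ eq → avoids _ (trans (proj₂ (W-tail t)) eq))

    position-trace : ∀ t → position (trace t) ≡ toℕ (base (W t))
    position-trace zero = refl
    position-trace (suc t) = trans (head-codeDart (dart (traversal t))) (cong toℕ (sym (base-W-head t)))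

    listed : ∀ t → darts t ∈ dartsAt (map codeArc (arcs G)) (position (trace t))
    listed t = subst (λ p → darts t ∈ dartsAt (map codeArc (arcs G)) p)
      (trans (cong toℕ (sym (base-W-tail t))) (sym (position-trace t)))
      (codeDart-listed (dart (traversal t)) (arc∈ (traversal t)))

    no-backtrack : ∀ t → t ≤ k → ¬ T (backtracks (trace t) (darts t))
    no-backtrack zero _ = backtracks-start b (darts 0)
    no-backtrack (suc t) t<k back =
      m<n⇒n≢0 t<k (csuc-fixed⇒k≡0 (advance r t) (sym (edge-inj same-edge)))
      where
        T₀ = traversal t
        T₁ = traversal (suc t)
        s = proj₁ (dart T₀)
        arc = proj₂ (dart T₀)
        reversal = backtracks-sound (trace t) (darts t) (darts (suc t)) back
        unpinned-middle : pinned G (head (dart T₀)) ≡ false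
        unpinned-middle = trans (sym (pinnedᶜ-toℕ _))
          (trans (cong pinnedᶜ (sym (head-codeDart (dart T₀)))) (proj₁ reversal))
        reversed : dart T₁ ≡ (not s , arc)
        reversed = codeDart-injective (proj₂ reversal)
        same-index : index T₀ ≡ index T₁
        same-index = reversal-same-index s arc unpinned-middle (begin
          proj₂ (dartEnds (dart T₀) (index T₀))   ≡⟨ cong proj₂ (ends≡ T₀) ⟩
          W (suc t)                              ≡⟨ cong proj₁ (ends≡ T₁) ⟨
          proj₁ (dartEnds (dart T₁) (index T₁))   ≡⟨ cong (λ d → proj₁ (dartEnds d (index T₁))) reversed ⟩
          proj₁ (dartEnds (not s , arc) (index T₁)) ∎)
          where open ≡-Reasoning
        same-edge : edge (advance r t) ≡ edge (advance r (suc t))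
        same-edge = Unique⇒lookup-injective edges! _ _ (begin
          edgeAt D (edge (advance r t))          ≡⟨ edge≡ T₀ ⟩
          arcEdge arc (index T₀)                 ≡⟨ cong (arcEdge arc) same-index ⟩
          arcEdge arc (index T₁)                 ≡⟨ cong (λ d → arcEdge (proj₂ d) (index T₁)) reversed ⟨
          arcEdge (proj₂ (dart T₁)) (index T₁)   ≡⟨ edge≡ T₁ ⟨
          edgeAt D (edge (advance r (suc t)))    ∎)
          where open ≡-Reasoning

    closes-at-end : ∀ depth → suc k ≤ depth → T (explore b depth (start b)) →
                    (∀ t → t ≤ k → ¬ T (halts b (trace t))) → T (closes b (trace (suc k)))
    closes-at-end depth K≤depth explored never-halts = explore-sound b depth (start b) darts k K≤depth explored
      λ t t≤k → never-halts t t≤k , listed t , no-backtrack t t≤k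

    returns : position (trace (suc k)) ≡ b
    returns = trans (position-trace (suc k)) (cong (λ i → toℕ (base (vert i))) (advance-period r))

    through-pinned : ∀ u → W 0 ≡ inj₁ u → ∀ depth → suc k ≤ depth → ¬ T (explore b depth (start b))
    through-pinned u W0≡u depth K≤depth explored = closes-pinned b b-pinned (trace (suc k)) returns
      (closes-at-end depth K≤depth explored λ t _ → halts-pinned b b-pinned (trace t))
      where
        b-pinned : pinnedᶜ b ≡ true
        b-pinned = trans (pinnedᶜ-toℕ _) (pinned-W 0 u W0≡u)

    module Unpinned (avoids : ∀ t u → W t ≢ inj₁ u) where

      level-step : ∀ t → level (W (suc t)) + backwardVoltage (darts t) ≡ level (W t) + forwardVoltage (darts t) [mod m ]
      level-step t = subst (λ e → level (proj₂ e) + backwardVoltage d ≡ level (proj₁ e) + forwardVoltage d [mod m ]) (ends≡ T₀)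
        (level-dartEnds d (index T₀) (λ u eq → avoids t u (trans (sym (cong proj₁ (ends≡ T₀))) eq))
                                     (λ u eq → avoids (suc t) u (trans (sym (cong proj₂ (ends≡ T₀))) eq)))
        where
          T₀ = traversal t
          d = dart T₀

      level-trace : ∀ t → level (W t) + backward (trace t) ≡ level (W 0) + forward (trace t) [mod m ]
      level-trace zero = ≡[mod]-refl
      level-trace (suc t) = begin
        level (W (suc t)) + (backward (trace t) + bv)  ≡⟨ x∙yz≈xz∙y (level (W (suc t))) (backward (trace t)) bv ⟩
        level (W (suc t)) + bv + backward (trace t)    ≈⟨ +-congʳ-[mod] (backward (trace t)) (level-step t) ⟩
        level (W t) + fv + backward (trace t)          ≡⟨ xy∙z≈xz∙y (level (W t)) fv (backward (trace t)) ⟩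
        level (W t) + backward (trace t) + fv          ≈⟨ +-congʳ-[mod] fv (level-trace t) ⟩
        level (W 0) + forward (trace t) + fv           ≡⟨ +-assoc (level (W 0)) (forward (trace t)) fv ⟩
        level (W 0) + (forward (trace t) + fv)         ∎
        where
          open ≡[mod]-Reasoning m
          fv = forwardVoltage (darts t)
          bv = backwardVoltage (darts t)

      avoiding-pinned : ∀ depth → suc k ≤ depth → ¬ T (explore b depth (start b))
      avoiding-pinned depth K≤depth explored = good-sound (closes⇒good b (trace (suc k)) returns closed) balanced
        where
          closed : T (closes b (trace (suc k)))
          closed = closes-at-end depth K≤depth explored λ t _ → halts-unpinned b (trace t)
            (trans (cong pinnedᶜ (position-trace t)) (trans (pinnedᶜ-toℕ _) (unpinned-W t (avoids t))))
          balanced : backward (trace (suc k)) ≡ forward (trace (suc k)) [mod m ]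
          balanced = +-cancelˡ-[mod] (level (W 0))
            (subst (λ i → level (vert i) + backward (trace (suc k)) ≡ level (W 0) + forward (trace (suc k)) [mod m ])
                   (advance-period r) (level-trace (suc k)))

  pinned-vertex? : (x : Vertex) → Dec (∃ λ u → x ≡ inj₁ u)
  pinned-vertex? (inj₁ u) = yes (u , refl)
  pinned-vertex? (inj₂ _) = no λ ()

  no-short-cycles : ∀ depth → (∀ v → T (explore (toℕ v) depth (start (toℕ v)))) → ∀ K → K ≤ depth → ¬ Cycle D K
  no-short-cycles depth explored zero _ C with () ← Cycle.nonempty C
  no-short-cycles depth explored (suc k) K≤depth C with any? (λ p → pinned-vertex? (Cycle.vert C p))
  ... | yes (r , u , eq) = ClosedWalk.through-pinned C r u eq depth K≤depth (explored _)
  ... | no avoids = ClosedWalk.Unpinned.avoiding-pinned C zero (λ t u eq → avoids (_ , u , eq)) depth K≤depth (explored _)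

-- Degrees and lifted cycles

baseGraph : VoltageGraph → Multigraph
baseGraph G = record
  { V = Fin (n G)
  ; _≟V_ = _≟ᶠ_
  ; vertices = allFin (n G)
  ; edges = map endpoints (arcs G)
  }

module Degrees (G : VoltageGraph) (m : ℕ) .{{_ : NonZero m}} where
  open Derived G m

  private
    _≟ᵥ_ = _≟V_ D

  incidence : Vertex → Vertex × Vertex → ℕ
  incidence x (y , z) = indicator (y ≟ᵥ x) + indicator (z ≟ᵥ x)

  baseIncidence : Fin (n G) → Arc (Fin (n G)) → ℕ
  baseIncidence v (u , w , a) = indicator (u ≟ᶠ v) + indicator (w ≟ᶠ v)

  baseDegree : ∀ v → degree (baseGraph G) v ≡ sum (map (baseIncidence v) (arcs G))
  baseDegree v = cong sum (sym (map-∘ (arcs G)))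

  liftCount : Vertex → Fin (n G) → (Fin m → Fin m) → ℕ
  liftCount x u g = sum (map (λ j → indicator (lift G m u (g j) ≟ᵥ x)) (allFin m))

  arcIncidence : ∀ x u w a → sum (map (incidence x) (arcEdges (u , w , a))) ≡ liftCount x u id + liftCount x w (shift a)
  arcIncidence x u w a = trans (cong sum (sym (map-∘ (allFin m)))) (sum-map-+ _ _ (allFin m))

  liftCount-pinned : ∀ {p} → pinned G p ≡ true → ∀ u g → liftCount (inj₁ p) u g ≡ m * indicator (u ≟ᶠ p)
  liftCount-pinned {p} pinned-p u g = trans (sum-allFin (λ j → indicator (lift G m u (g j) ≟ᵥ inj₁ p))) (sum-tabulate-const _ term)
    where
      term : ∀ j → indicator (lift G m u (g j) ≟ᵥ inj₁ p) ≡ indicator (u ≟ᶠ p)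
      term j with u ≟ᶠ p
      ... | yes refl = indicator-yes (lift G m u (g j) ≟ᵥ inj₁ p) (lift-pinned (g j) pinned-p)
      ... | no u≢p = indicator-no (lift G m u (g j) ≟ᵥ inj₁ p) λ eq → u≢p (trans (sym (base-lift u (g j))) (cong base eq))

  liftCount-unpinned : ∀ {v} → pinned G v ≡ false → ∀ i u (g : Fin m → Fin m) j₀ →
                       g j₀ ≡ i → (∀ j → g j ≡ i → j ≡ j₀) →
                       liftCount (inj₂ (v , i)) u g ≡ indicator (u ≟ᶠ v)
  liftCount-unpinned {v} unpinned-v i u g j₀ g-j₀ g-unique with u ≟ᶠ v
  ... | yes refl = trans (sum-allFin term) (sum-tabulate-delta term j₀
          (indicator-yes (lift G m u (g j₀) ≟ᵥ inj₂ (v , i))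
            (trans (lift-unpinned (g j₀) unpinned-v) (cong (λ k → inj₂ (u , k)) g-j₀)))
          λ j j≢j₀ → indicator-no (lift G m u (g j) ≟ᵥ inj₂ (v , i))
            λ eq → j≢j₀ (g-unique j (proj₂ (lift≡inj₂⇒unpinned eq))))
    where
      term : Fin m → ℕ
      term j = indicator (lift G m u (g j) ≟ᵥ inj₂ (v , i))
  ... | no u≢v = trans (sum-allFin term) (trans (sum-tabulate-const term λ j →
          indicator-no (lift G m u (g j) ≟ᵥ inj₂ (v , i)) λ eq → u≢v (trans (sym (base-lift u (g j))) (cong base eq))) (*-zeroʳ m))
    where
      term : Fin m → ℕ
      term j = indicator (lift G m u (g j) ≟ᵥ inj₂ (v , i))

  degree-derived : ∀ x → degree D x ≡ sum (map (λ arc → sum (map (incidence x) (arcEdges arc))) (arcs G))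
  degree-derived x = sum-map-concatMap (incidence x) arcEdges (arcs G)

  degree-unpinned : ∀ {v} → pinned G v ≡ false → ∀ i → degree D (inj₂ (v , i)) ≡ degree (baseGraph G) v
  degree-unpinned {v} unpinned-v i =
    trans (degree-derived (inj₂ (v , i))) (trans (cong sum (map-cong perArc (arcs G))) (sym (baseDegree v)))
    where
      perArc : ∀ arc → sum (map (incidence (inj₂ (v , i))) (arcEdges arc)) ≡ baseIncidence v arc
      perArc (u , w , a) = trans (arcIncidence _ u w a) (cong₂ _+_
        (liftCount-unpinned unpinned-v i u id i refl (λ _ → id))
        (liftCount-unpinned unpinned-v i w (shift a) (proj₁ preimage) (proj₂ preimage)
          λ j eq → shift-injective a (trans eq (sym (proj₂ preimage)))))
        where preimage = shift-surjective a i

  degree-pinned : ∀ {p} → pinned G p ≡ true → degree D (inj₁ p) ≡ m * degree (baseGraph G) p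
  degree-pinned {p} pinned-p = begin
    degree D (inj₁ p)                                ≡⟨ degree-derived (inj₁ p) ⟩
    sum (map (λ arc → sum (map (incidence (inj₁ p)) (arcEdges arc))) (arcs G))  ≡⟨ cong sum (map-cong perArc (arcs G)) ⟩
    sum (map (λ arc → m * baseIncidence p arc) (arcs G))  ≡⟨ sum-map-*ˡ m (baseIncidence p) (arcs G) ⟩
    m * sum (map (baseIncidence p) (arcs G))           ≡⟨ cong (m *_) (baseDegree p) ⟨
    m * degree (baseGraph G) p                       ∎
    where
      open ≡-Reasoning
      perArc : ∀ arc → sum (map (incidence (inj₁ p)) (arcEdges arc)) ≡ m * baseIncidence p arc
      perArc (u , w , a) = trans (arcIncidence _ u w a)
        (trans (cong₂ _+_ (liftCount-pinned pinned-p u id) (liftCount-pinned pinned-p w (shift a)))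
               (sym (*-distribˡ-+ m _ _)))

module Counting (G : VoltageGraph) (m : ℕ) .{{_ : NonZero m}} where
  open Derived G m

  pinnedBase unpinnedBase : List (Fin (n G))
  pinnedBase = filterᵇ (pinned G) (allFin (n G))
  unpinnedBase = filterᵇ (not ∘ pinned G) (allFin (n G))

  fibre : Fin (n G) → List Vertex
  fibre v = map (λ i → inj₂ (v , i)) (allFin m)

  pinnedVertices unpinnedVertices : List Vertex
  pinnedVertices = map inj₁ pinnedBase
  unpinnedVertices = concatMap fibre unpinnedBase

  ∈-pinnedVertices : ∀ {x} → x ∈ pinnedVertices → ∃ λ p → x ≡ inj₁ p × pinned G p ≡ true
  ∈-pinnedVertices x∈ with ∈-map⁻ inj₁ x∈
  ... | p , p∈ , refl = p , refl , Equivalence.to T-≡ (proj₂ (∈-filter⁻ (T? ∘ pinned G) {xs = allFin (n G)} p∈))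

  ∈-unpinnedVertices : ∀ {x} → x ∈ unpinnedVertices → ∃₂ λ v i → x ≡ inj₂ (v , i) × pinned G v ≡ false
  ∈-unpinnedVertices x∈ with find (∈-concatMap⁻ fibre {xs = unpinnedBase} x∈)
  ... | v , v∈ , x∈fibre with ∈-map⁻ (λ i → inj₂ (v , i)) x∈fibre
  ... | i , _ , refl = v , i , refl , Equivalence.to T-not-≡ (proj₂ (∈-filter⁻ (T? ∘ not ∘ pinned G) {xs = allFin (n G)} v∈))

  ∈-vertices : ∀ {x} → x ∈ vertices D →
               (∃ λ p → x ≡ inj₁ p × pinned G p ≡ true) ⊎ (∃₂ λ v i → x ≡ inj₂ (v , i) × pinned G v ≡ false)
  ∈-vertices x∈ with ∈-++⁻ pinnedVertices x∈
  ... | inj₁ x∈p = inj₁ (∈-pinnedVertices x∈p)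
  ... | inj₂ x∈u = inj₂ (∈-unpinnedVertices x∈u)

  hasDegree : ℕ → Vertex → Bool
  hasDegree d x = does (degree D x ≟ d)

  hasDegree-intro : ∀ {d x} → degree D x ≡ d → T (hasDegree d x)
  hasDegree-intro {d} {x} eq = Equivalence.from T-≡ (dec-true (degree D x ≟ d) eq)

  hasDegree-elim : ∀ {d x} → T (hasDegree d x) → degree D x ≡ d
  hasDegree-elim {d} {x} = ≡ᵇ⇒≡ (degree D x) d

  countDeg-split : ∀ d → countDeg D d ≡ length (filterᵇ (hasDegree d) pinnedVertices) + length (filterᵇ (hasDegree d) unpinnedVertices)
  countDeg-split d = trans (cong length (filter-++ (T? ∘ hasDegree d) pinnedVertices unpinnedVertices))
    (length-++ (filterᵇ (hasDegree d) pinnedVertices))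

  length-unpinnedVertices : length unpinnedVertices ≡ length unpinnedBase * m
  length-unpinnedVertices = length-concatMap-const fibre m unpinnedBase λ v → trans (length-map _ (allFin m)) (length-tabulate _)

  module _ {dₚ dᵤ : ℕ} (dₚ≢dᵤ : dₚ ≢ dᵤ)
           (degree-p : ∀ {p} → pinned G p ≡ true → degree D (inj₁ p) ≡ dₚ)
           (degree-u : ∀ {v} → pinned G v ≡ false → ∀ i → degree D (inj₂ (v , i)) ≡ dᵤ) where

    countDeg-pinned : countDeg D dₚ ≡ length pinnedBase
    countDeg-pinned = trans (countDeg-split dₚ) (trans (cong₂ _+_
      (trans (length-filterᵇ-all _ pinnedVertices pinned-has-dₚ) (length-map inj₁ pinnedBase))
      (length-filterᵇ-none _ unpinnedVertices unpinned-lacks-dₚ)) (+-identityʳ _))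
      where
        pinned-has-dₚ : ∀ x → x ∈ pinnedVertices → T (hasDegree dₚ x)
        pinned-has-dₚ x x∈ with p , refl , pinned-p ← ∈-pinnedVertices x∈ = hasDegree-intro (degree-p pinned-p)
        unpinned-lacks-dₚ : ∀ x → x ∈ unpinnedVertices → ¬ T (hasDegree dₚ x)
        unpinned-lacks-dₚ x x∈ has with v , i , refl , unpinned-v ← ∈-unpinnedVertices x∈ =
          dₚ≢dᵤ (trans (sym (hasDegree-elim has)) (degree-u unpinned-v i))

    countDeg-unpinned : countDeg D dᵤ ≡ length unpinnedBase * m
    countDeg-unpinned = trans (countDeg-split dᵤ) (cong₂ _+_
      (length-filterᵇ-none _ pinnedVertices pinned-lacks-dᵤ)
      (trans (length-filterᵇ-all _ unpinnedVertices unpinned-has-dᵤ) length-unpinnedVertices))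
      where
        pinned-lacks-dᵤ : ∀ x → x ∈ pinnedVertices → ¬ T (hasDegree dᵤ x)
        pinned-lacks-dᵤ x x∈ has with p , refl , pinned-p ← ∈-pinnedVertices x∈ =
          dₚ≢dᵤ (trans (sym (degree-p pinned-p)) (hasDegree-elim has))
        unpinned-has-dᵤ : ∀ x → x ∈ unpinnedVertices → T (hasDegree dᵤ x)
        unpinned-has-dᵤ x x∈ with v , i , refl , unpinned-v ← ∈-unpinnedVertices x∈ = hasDegree-intro (degree-u unpinned-v i)

module LiftedCycles (G : VoltageGraph) (m : ℕ) .{{_ : NonZero m}} where
  open Derived G m

  arcEdge-voltage-zero : ∀ arc j → voltage arc ≡ 0 →
                         arcEdge arc j ≡ (lift G m (proj₁ (endpoints arc)) j , lift G m (proj₂ (endpoints arc)) j)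
  arcEdge-voltage-zero (v , w , .0) j refl = cong (λ i → lift G m v j , lift G m w i) (shift-zero j)

  zero-voltage-cycle : ∀ {k} (vs : Fin (suc k) → Fin (n G)) (as : Fin (suc k) → Arc (Fin (n G))) (j : Fin m) →
    (∀ i → as i ∈ arcs G) → (∀ i → voltage (as i) ≡ 0) →
    (∀ i → endpoints (as i) ≡ (vs i , vs (csuc i)) ⊎ endpoints (as i) ≡ (vs (csuc i) , vs i)) →
    (∀ {i i′} → vs i ≡ vs i′ → i ≡ i′) → (∀ {i i′} → endpoints (as i) ≡ endpoints (as i′) → i ≡ i′) →
    Cycle D (suc k)
  zero-voltage-cycle vs as j as∈ flat joined vs-injective as-injective = record
    { nonempty = s≤s z≤n
    ; vert = λ i → lift G m (vs i) j
    ; edge = e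
    ; vert-inj = λ {i} {i′} eq → vs-injective (trans (sym (base-lift (vs i) j)) (trans (cong base eq) (base-lift (vs i′) j)))
    ; edge-inj = λ {i} {i′} eq → as-injective (begin
        endpoints (as i)                    ≡⟨ baseEdge-arcEdge (as i) j ⟨
        baseEdge (arcEdge (as i) j)         ≡⟨ cong baseEdge (trans (sym (e≡ i)) (trans (cong (edgeAt D) eq) (e≡ i′))) ⟩
        baseEdge (arcEdge (as i′) j)        ≡⟨ baseEdge-arcEdge (as i′) j ⟩
        endpoints (as i′)                   ∎)
    ; joins = joins
    }
    where
      open ≡-Reasoning
      e : Fin _ → EdgeIx D
      e i = proj₁ (edge-of-arc (as∈ i) j)
      e≡ : ∀ i → edgeAt D (e i) ≡ arcEdge (as i) j
      e≡ i = proj₂ (edge-of-arc (as∈ i) j)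
      lifted : ∀ i → edgeAt D (e i) ≡ (lift G m (proj₁ (endpoints (as i))) j , lift G m (proj₂ (endpoints (as i))) j)
      lifted i = trans (e≡ i) (arcEdge-voltage-zero (as i) j (flat i))
      joins : ∀ i → Joins D (e i) (lift G m (vs i) j) (lift G m (vs (csuc i)) j)
      joins i with joined i
      ... | inj₁ eq = inj₁ (trans (cong proj₁ (lifted i)) (cong (λ p → lift G m (proj₁ p) j) eq) ,
                            trans (cong proj₂ (lifted i)) (cong (λ p → lift G m (proj₂ p) j) eq))
      ... | inj₂ eq = inj₂ (trans (cong proj₁ (lifted i)) (cong (λ p → lift G m (proj₁ p) j) eq) ,
                            trans (cong proj₂ (lifted i)) (cong (λ p → lift G m (proj₂ p) j) eq))

isShort : ℕ → Bool
isShort d = (d ≡ᵇ 1) ∨ (d ≡ᵇ 2) ∨ (d ≡ᵇ 3) ∨ (d ≡ᵇ 6)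

unbalanced : ℕ → ℕ → Bool
unbalanced P N = isShort (P ∸ N) ∨ isShort (N ∸ P)

∤6 : ∀ {m} → 4 ≤ m → m ≢ 6 → ¬ m ∣ 6
∤6 {1} (s≤s ())
∤6 {2} (s≤s (s≤s ()))
∤6 {3} (s≤s (s≤s (s≤s ())))
∤6 {4} _ _ = toWitnessFalse {a? = 4 ∣? 6} _
∤6 {5} _ _ = toWitnessFalse {a? = 5 ∣? 6} _
∤6 {6} _ m≢6 _ = m≢6 refl
∤6 {suc (suc (suc (suc (suc (suc (suc _))))))} _ _ m∣6 = <⇒≱ (s≤s (s≤s (s≤s (s≤s (s≤s (s≤s (s≤s z≤n))))))) (∣⇒≤ m∣6)

isShort⇒∤ : ∀ {m} → 4 ≤ m → m ≢ 6 → ∀ d → T (isShort d) → ¬ m ∣ d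
isShort⇒∤ 4≤m _ 1 _ m∣d = <⇒≱ (s≤s (s≤s z≤n)) (≤-trans 4≤m (∣⇒≤ m∣d))
isShort⇒∤ 4≤m _ 2 _ m∣d = <⇒≱ (s≤s (s≤s (s≤s z≤n))) (≤-trans 4≤m (∣⇒≤ m∣d))
isShort⇒∤ 4≤m _ 3 _ m∣d = <⇒≱ (s≤s (s≤s (s≤s (s≤s z≤n)))) (≤-trans 4≤m (∣⇒≤ m∣d))
isShort⇒∤ 4≤m m≢6 6 _ = ∤6 4≤m m≢6

unbalanced⇒≢[mod] : ∀ {m} → 4 ≤ m → m ≢ 6 → ∀ {P N} → T (unbalanced P N) → ¬ N ≡ P [mod m ]
unbalanced⇒≢[mod] 4≤m m≢6 {P} {N} unb N≈P with Equivalence.to T-∨ unb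
... | inj₁ short = isShort⇒∤ 4≤m m≢6 (P ∸ N) short (≡[mod]⇒∣∸ N≈P)
... | inj₂ short = isShort⇒∤ 4≤m m≢6 (N ∸ P) short (≡[mod]⇒∣∸ (≡[mod]-sym N≈P))

isPinnedᶜ : ℕ → Bool
isPinnedᶜ c = (c ≡ᵇ toℕ x*) ∨ (c ≡ᵇ toℕ y*)

isPinnedᶜ-toℕ : ∀ v → isPinnedᶜ (toℕ v) ≡ isPinned v
isPinnedᶜ-toℕ = from-yes (all? λ v → isPinnedᶜ (toℕ v) ≟ᴮ isPinned v)

open Search isPinnedᶜ (map codeArc (arcs G10)) unbalanced

G10-explored : ∀ v → T (explore (toℕ v) 9 (start (toℕ v)))
G10-explored = from-yes (all? λ (v : Fin 26) → T? (explore (toℕ v) 9 (start (toℕ v))))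

G10-baseDegree : ∀ v → degree (baseGraph G10) v ≡ (if isPinned v then 1 else 3)
G10-baseDegree = from-yes (all? λ (v : Fin 26) → degree (baseGraph G10) v ≟ (if isPinned v then 1 else 3))

tenCycle : Fin 10 → Fin 26
tenCycle = Vec.lookup (x111 ∷ y101 ∷ y10 ∷ y1 ∷ y ∷ y0 ∷ x0 ∷ x ∷ x1 ∷ x11 ∷ [])

tenCycleArcs : Fin 10 → Arc (Fin 26)
tenCycleArcs = Vec.lookup
  ((x111 , y101 , 0) ∷ (y10 , y101 , 0) ∷ (y1 , y10 , 0) ∷ (y , y1 , 0) ∷ (y , y0 , 0) ∷
   (x0 , y0 , 0) ∷ (x , x0 , 0) ∷ (x , x1 , 0) ∷ (x1 , x11 , 0) ∷ (x11 , x111 , 0) ∷ [])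

module _ (m : ℕ) .{{_ : NonZero m}} where
  open Derived G10 m
  open Degrees G10 m

  G10-edges-unique : Unique (edges D)
  G10-edges-unique = edges-unique
    (from-yes (All.all? (λ { (v , w , _) → (isPinned v ≟ᴮ false) ⊎-dec (isPinned w ≟ᴮ false) }) (arcs G10)))
    (from-yes (allPairs? (λ arc arc′ → ¬? (endpoints arc ≟ₑ endpoints arc′)) (arcs G10)))
    where _≟ₑ_ = ×-≡-dec _≟ᶠ_ _≟ᶠ_

  G10-tenCycle : 4 ≤ m → Cycle D 10
  G10-tenCycle 4≤m = LiftedCycles.zero-voltage-cycle G10 m tenCycle tenCycleArcs (fromℕ< (≤-trans (s≤s z≤n) 4≤m))
    (from-yes (all? λ i → tenCycleArcs i ∈? arcs G10))
    (from-yes (all? λ i → voltage (tenCycleArcs i) ≟ 0))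
    (from-yes (all? λ i → (endpoints (tenCycleArcs i) ≟ₑ (tenCycle i , tenCycle (csuc i)))
                   ⊎-dec (endpoints (tenCycleArcs i) ≟ₑ (tenCycle (csuc i) , tenCycle i))))
    (λ {i} {j} → from-yes (injective? _≟ᶠ_ tenCycle) i j)
    (λ {i} {j} → from-yes (injective? _≟ₑ_ (endpoints ∘ tenCycleArcs)) i j)
    where
      _≟ₑ_ = ×-≡-dec _≟ᶠ_ _≟ᶠ_
      open import Data.List.Membership.DecPropositional (×-≡-dec _≟ᶠ_ (×-≡-dec _≟ᶠ_ _≟_)) using (_∈?_)

  G10-degree-pinned : ∀ {p} → isPinned p ≡ true → degree D (inj₁ p) ≡ m
  G10-degree-pinned {p} pinned-p = trans (degree-pinned pinned-p)
    (trans (cong (m *_) (trans (G10-baseDegree p) (cong (λ b → if b then 1 else 3) pinned-p))) (*-identityʳ m))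

  G10-degree-unpinned : ∀ {v} → isPinned v ≡ false → ∀ i → degree D (inj₂ (v , i)) ≡ 3
  G10-degree-unpinned {v} unpinned-v i = trans (degree-unpinned unpinned-v i)
    (trans (G10-baseDegree v) (cong (λ b → if b then 1 else 3) unpinned-v))

theorem3 : (m : ℕ) .{{_ : NonZero m}} → 4 ≤ m → m ≢ 6 →
    HasGirth (derived G10 m) 10
    × (∀ v → v ∈ vertices (derived G10 m) → degree (derived G10 m) v ≡ 3 ⊎ degree (derived G10 m) v ≡ m)
    × degree (derived G10 m) (inj₁ x*) ≡ m
    × degree (derived G10 m) (inj₁ y*) ≡ m
    × countDeg (derived G10 m) m ≡ 2
    × countDeg (derived G10 m) 3 ≡ 24 * m
theorem3 m 4≤m m≢6 =
  (G10-tenCycle m 4≤m , λ k k<10 → no-short-cycles 9 G10-explored k (≤-pred k<10)) ,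
  degree-3-or-m ,
  G10-degree-pinned m refl ,
  G10-degree-pinned m refl ,
  countDeg-pinned m≢3 (G10-degree-pinned m) (G10-degree-unpinned m) ,
  countDeg-unpinned m≢3 (G10-degree-pinned m) (G10-degree-unpinned m)
  where
    open ShortCycles G10 m isPinnedᶜ isPinnedᶜ-toℕ unbalanced (unbalanced⇒≢[mod] 4≤m m≢6) (G10-edges-unique m)
    open Counting G10 m

    m≢3 : m ≢ 3
    m≢3 = <⇒≢ 4≤m ∘ sym

    degree-3-or-m : ∀ v → v ∈ vertices (derived G10 m) → degree (derived G10 m) v ≡ 3 ⊎ degree (derived G10 m) v ≡ m
    degree-3-or-m v v∈ with ∈-vertices v∈
    ... | inj₁ (p , refl , pinned-p) = inj₂ (G10-degree-pinned m pinned-p)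
    ... | inj₂ (u , i , refl , unpinned-u) = inj₁ (G10-degree-unpinned m unpinned-u i)
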